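{- Let $\mathcal L$ be either $\mathcal N4$ or any conservative expansion of $\mathcal N4$. Then $\mathcal L$ and Nelson's logic $\mathcal S$ are incomparable (neither consequence relation, restricted to formulas of the common language, is contained in the other) under each of the following two identifications: (i) the implication $\Rightarrow$ of $\mathcal S$ is identified with the weak implication $\to$ of $\mathcal N4$, the common language being $\langle\land,\lor,\to,\neg\rangle$; (ii) the implication $\Rightarrow$ of $\mathcal S$ is identified with the strong implication $\varphi\Rightarrow\psi:=(\varphi\to\psi)\land(\neg\psi\to\neg\varphi)$ of $\mathcal N4$, the common language being $\langle\land,\lor,\Rightarrow,\neg\rangle$.
   Context: $\mathcal N4$ (paraconsistent Nelson logic) is the logic in the language $\langle\land,\lor,\to,\neg\rangle$ given by modus ponens for $\to$ and the axiom schemata (with $\varphi\leftrightarrow\psi:=(\varphi\to\psi)\land(\psi\to\varphi)$): (N1) $\phi\to(\psi\to\phi)$; (N2) $(\phi\to(\psi\to\gamma))\to((\phi\to\psi)\to(\phi\to\gamma))$; (N3) $(\phi\land\psi)\to\phi$; (N4) $(\phi\land\psi)\to\psi$; (N5) $(\phi\to\psi)\to((\phi\to\gamma)\to(\phi\to(\psi\land\gamma)))$; (N6) $\phi\to(\phi\lor\psi)$; (N7) $\psi\to(\phi\lor\psi)$; (N8) $(\phi\to\gamma)\to((\psi\to\gamma)\to((\phi\lor\psi)\to\gamma))$; (N9) $\neg\neg\phi\leftrightarrow\phi$; (N10) $\neg(\phi\lor\psi)\leftrightarrow(\neg\phi\land\neg\psi)$; (N11) $\neg(\phi\land\psi)\leftrightarrow(\neg\phi\lor\neg\psi)$;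 (N12) $\neg(\phi\to\psi)\leftrightarrow(\phi\land\neg\psi)$. A conservative expansion of a logic is a logic in a larger language whose consequence relation coincides with the original one on formulas of the original language. Nelson's logic $\mathcal S$ is the sentential logic in the language $\langle\land,\lor,\Rightarrow,\neg,0\rangle$ given by the following Hilbert-style calculus. Abbreviations: $\phi\Leftrightarrow\psi:=(\phi\Rightarrow\psi)\land(\psi\Rightarrow\phi)$, $1:=\neg 0$, $\phi\Rightarrow^2\psi:=\phi\Rightarrow(\phi\Rightarrow\psi)$; for a finite (possibly empty) list $\Gamma=(\phi_1,\dots,\phi_n)$, $\Gamma\Rightarrow\phi:=\phi_1\Rightarrow(\phi_2\Rightarrow(\cdots(\phi_n\Rightarrow\phi)\cdots))$ and $\Gamma\Rightarrow^2\phi:=\phi_1\Rightarrow^2(\cdots(\phi_n\Rightarrow^2\phi)\cdots)$, both $\phi$ if $\Gamma$ is empty. Axioms: (A1) $\phi\Rightarrow\phi$; (A2) $0\Rightarrow\psi$; (A3) $\neg\phi\Rightarrow(\phi\Rightarrow0)$; (A4) $1$; (A5) $(\phi\Rightarrow\psi)\Leftrightarrow(\neg\psi\Rightarrow\neg\phi)$. Rules ("premisses / conclusion", for every finite list $\Gamma$): (P) $\Gamma\Rightarrow(\phi\Rightarrow(\psi\Rightarrow\gamma))$ / $\Gamma\Rightarrow(\psi\Rightarrow(\phi\Rightarrow\gamma))$; (C) $\phi\Rightarrow(\phi\Rightarrow(\phi\Rightarrow\gamma))$ / $\phi\Rightarrow(\phi\Rightarrow\gamma)$; (E) $\Gamma\Rightarrow\phi$,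 $\phi\Rightarrow\gamma$ / $\Gamma\Rightarrow\gamma$; ($\Rightarrow$l) $\Gamma\Rightarrow\phi$, $\psi\Rightarrow\gamma$ / $\Gamma\Rightarrow((\phi\Rightarrow\psi)\Rightarrow\gamma)$; ($\Rightarrow$r) $\gamma$ / $\phi\Rightarrow\gamma$; ($\land$l1) $\phi\Rightarrow\gamma$ / $(\phi\land\psi)\Rightarrow\gamma$; ($\land$l2) $\psi\Rightarrow\gamma$ / $(\phi\land\psi)\Rightarrow\gamma$; ($\land$r) $\Gamma\Rightarrow\phi$, $\Gamma\Rightarrow\psi$ / $\Gamma\Rightarrow(\phi\land\psi)$; ($\lor$l1) $\phi\Rightarrow\gamma$, $\psi\Rightarrow\gamma$ / $(\phi\lor\psi)\Rightarrow\gamma$; ($\lor$l2) $\phi\Rightarrow^2\gamma$, $\psi\Rightarrow^2\gamma$ / $(\phi\lor\psi)\Rightarrow^2\gamma$; ($\lor$r1) $\Gamma\Rightarrow\phi$ / $\Gamma\Rightarrow(\phi\lor\psi)$; ($\lor$r2) $\Gamma\Rightarrow\psi$ / $\Gamma\Rightarrow(\phi\lor\psi)$; ($\neg\Rightarrow$l) $(\phi\land\neg\psi)\Rightarrow\gamma$ / $\neg(\phi\Rightarrow\psi)\Rightarrow\gamma$; ($\neg\Rightarrow$r) $\Gamma\Rightarrow^2(\phi\land\neg\psi)$ / $\Gamma\Rightarrow^2\neg(\phi\Rightarrow\psi)$; ($\neg\land$l) $(\neg\phi\lor\neg\psi)\Rightarrow\gamma$ / $\neg(\phi\land\psi)\Rightarrow\gamma$;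 ($\neg\land$r) $\Gamma\Rightarrow(\neg\phi\lor\neg\psi)$ / $\Gamma\Rightarrow\neg(\phi\land\psi)$; ($\neg\lor$l) $(\neg\phi\land\neg\psi)\Rightarrow\gamma$ / $\neg(\phi\lor\psi)\Rightarrow\gamma$; ($\neg\lor$r) $\Gamma\Rightarrow(\neg\phi\land\neg\psi)$ / $\Gamma\Rightarrow\neg(\phi\lor\psi)$; ($\neg\neg$l) $\phi\Rightarrow\gamma$ / $\neg\neg\phi\Rightarrow\gamma$; ($\neg\neg$r) $\Gamma\Rightarrow\phi$ / $\Gamma\Rightarrow\neg\neg\phi$. -}

module Defs where

open import Data.Nat using (ℕ)
open import Data.List using (List; foldr)
open import Data.Vec using (Vec; []; _∷_)
open import Data.Product using (Σ; _×_)
open import Relation.Binary.PropositionalEquality using (_≡_)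
open import Relation.Nullary using (¬_)

image : {A B : Set} → (A → B) → (A → Set) → (B → Set)
image f Γ ψ = Σ _ (λ γ → Γ γ × f γ ≡ ψ)

_⇔_ : Set → Set → Set
A ⇔ B = (A → B) × (B → A)

data Fm4 : Set where
  v4   : ℕ → Fm4
  and4 : Fm4 → Fm4 → Fm4
  or4  : Fm4 → Fm4 → Fm4
  imp4 : Fm4 → Fm4 → Fm4
  neg4 : Fm4 → Fm4

iff4 : Fm4 → Fm4 → Fm4
iff4 φ ψ = and4 (imp4 φ ψ) (imp4 ψ φ)

data _⊢N4_ (Γ : Fm4 → Set) : Fm4 → Set where
  hyp : ∀ {φ} → Γ φ → Γ ⊢N4 φ
  n1  : ∀ φ ψ → Γ ⊢N4 imp4 φ (imp4 ψ φ)
  n2  : ∀ φ ψ γ → Γ ⊢N4 imp4 (imp4 φ (imp4 ψ γ)) (imp4 (imp4 φ ψ) (imp4 φ γ))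
  n3  : ∀ φ ψ → Γ ⊢N4 imp4 (and4 φ ψ) φ
  n4  : ∀ φ ψ → Γ ⊢N4 imp4 (and4 φ ψ) ψ
  n5  : ∀ φ ψ γ → Γ ⊢N4 imp4 (imp4 φ ψ) (imp4 (imp4 φ γ) (imp4 φ (and4 ψ γ)))
  n6  : ∀ φ ψ → Γ ⊢N4 imp4 φ (or4 φ ψ)
  n7  : ∀ φ ψ → Γ ⊢N4 imp4 ψ (or4 φ ψ)
  n8  : ∀ φ ψ γ → Γ ⊢N4 imp4 (imp4 φ γ) (imp4 (imp4 ψ γ) (imp4 (or4 φ ψ) γ))
  n9  : ∀ φ → Γ ⊢N4 iff4 (neg4 (neg4 φ)) φ
  n10 : ∀ φ ψ → Γ ⊢N4 iff4 (neg4 (or4 φ ψ)) (and4 (neg4 φ) (neg4 ψ))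
  n11 : ∀ φ ψ → Γ ⊢N4 iff4 (neg4 (and4 φ ψ)) (or4 (neg4 φ) (neg4 ψ))
  n12 : ∀ φ ψ → Γ ⊢N4 iff4 (neg4 (imp4 φ ψ)) (and4 φ (neg4 ψ))
  mp  : ∀ {φ ψ} → Γ ⊢N4 imp4 φ ψ → Γ ⊢N4 φ → Γ ⊢N4 ψ

data FmS : Set where
  vS    : ℕ → FmS
  andS  : FmS → FmS → FmS
  orS   : FmS → FmS → FmS
  impS  : FmS → FmS → FmS
  negS  : FmS → FmS
  zeroS : FmS

oneS : FmS
oneS = negS zeroS

iffS : FmS → FmS → FmS
iffS φ ψ = andS (impS φ ψ) (impS ψ φ)

imp2S : FmS → FmS → FmS
imp2S φ ψ = impS φ (impS φ ψ)

chain : List FmS → FmS → FmS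
chain Γ φ = foldr impS φ Γ

chain2 : List FmS → FmS → FmS
chain2 Γ φ = foldr imp2S φ Γ

data _⊢S_ (Δ : FmS → Set) : FmS → Set where
  hyp  : ∀ {φ} → Δ φ → Δ ⊢S φ
  a1   : ∀ φ → Δ ⊢S impS φ φ
  a2   : ∀ ψ → Δ ⊢S impS zeroS ψ
  a3   : ∀ φ → Δ ⊢S impS (negS φ) (impS φ zeroS)
  a4   : Δ ⊢S oneS
  a5   : ∀ φ ψ → Δ ⊢S iffS (impS φ ψ) (impS (negS ψ) (negS φ))
  rP   : ∀ Γ φ ψ γ → Δ ⊢S chain Γ (impS φ (impS ψ γ)) → Δ ⊢S chain Γ (impS ψ (impS φ γ))
  rC   : ∀ φ γ → Δ ⊢S impS φ (impS φ (impS φ γ)) → Δ ⊢S impS φ (impS φ γ)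
  rE   : ∀ Γ φ γ → Δ ⊢S chain Γ φ → Δ ⊢S impS φ γ → Δ ⊢S chain Γ γ
  r⇒l  : ∀ Γ φ ψ γ → Δ ⊢S chain Γ φ → Δ ⊢S impS ψ γ → Δ ⊢S chain Γ (impS (impS φ ψ) γ)
  r⇒r  : ∀ φ γ → Δ ⊢S γ → Δ ⊢S impS φ γ
  r∧l1 : ∀ φ ψ γ → Δ ⊢S impS φ γ → Δ ⊢S impS (andS φ ψ) γ
  r∧l2 : ∀ φ ψ γ → Δ ⊢S impS ψ γ → Δ ⊢S impS (andS φ ψ) γ
  r∧r  : ∀ Γ φ ψ → Δ ⊢S chain Γ φ → Δ ⊢S chain Γ ψ → Δ ⊢S chain Γ (andS φ ψ)
  r∨l1 : ∀ φ ψ γ → Δ ⊢S impS φ γ → Δ ⊢S impS ψ γ → Δ ⊢S impS (orS φ ψ) γ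
  r∨l2 : ∀ φ ψ γ → Δ ⊢S imp2S φ γ → Δ ⊢S imp2S ψ γ → Δ ⊢S imp2S (orS φ ψ) γ
  r∨r1 : ∀ Γ φ ψ → Δ ⊢S chain Γ φ → Δ ⊢S chain Γ (orS φ ψ)
  r∨r2 : ∀ Γ φ ψ → Δ ⊢S chain Γ ψ → Δ ⊢S chain Γ (orS φ ψ)
  r¬⇒l : ∀ φ ψ γ → Δ ⊢S impS (andS φ (negS ψ)) γ → Δ ⊢S impS (negS (impS φ ψ)) γ
  r¬⇒r : ∀ Γ φ ψ → Δ ⊢S chain2 Γ (andS φ (negS ψ)) → Δ ⊢S chain2 Γ (negS (impS φ ψ))
  r¬∧l : ∀ φ ψ γ → Δ ⊢S impS (orS (negS φ) (negS ψ)) γ → Δ ⊢S impS (negS (andS φ ψ)) γ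
  r¬∧r : ∀ Γ φ ψ → Δ ⊢S chain Γ (orS (negS φ) (negS ψ)) → Δ ⊢S chain Γ (negS (andS φ ψ))
  r¬∨l : ∀ φ ψ γ → Δ ⊢S impS (andS (negS φ) (negS ψ)) γ → Δ ⊢S impS (negS (orS φ ψ)) γ
  r¬∨r : ∀ Γ φ ψ → Δ ⊢S chain Γ (andS (negS φ) (negS ψ)) → Δ ⊢S chain Γ (negS (orS φ ψ))
  r¬¬l : ∀ φ γ → Δ ⊢S impS φ γ → Δ ⊢S impS (negS (negS φ)) γ
  r¬¬r : ∀ Γ φ → Δ ⊢S chain Γ φ → Δ ⊢S chain Γ (negS (negS φ))

data FormL (Op : Set) (ar : Op → ℕ) : Set where
  vL   : ℕ → FormL Op ar
  andL : FormL Op ar → FormL Op ar → FormL Op ar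
  orL  : FormL Op ar → FormL Op ar → FormL Op ar
  impL : FormL Op ar → FormL Op ar → FormL Op ar
  negL : FormL Op ar → FormL Op ar
  opL  : (o : Op) → Vec (FormL Op ar) (ar o) → FormL Op ar

module _ {Op : Set} {ar : Op → ℕ} where

  mutual
    substL : (ℕ → FormL Op ar) → FormL Op ar → FormL Op ar
    substL σ (vL n)     = σ n
    substL σ (andL φ ψ) = andL (substL σ φ) (substL σ ψ)
    substL σ (orL φ ψ)  = orL (substL σ φ) (substL σ ψ)
    substL σ (impL φ ψ) = impL (substL σ φ) (substL σ ψ)
    substL σ (negL φ)   = negL (substL σ φ)
    substL σ (opL o xs) = opL o (substVec σ xs)

    substVec : ∀ {n} → (ℕ → FormL Op ar) → Vec (FormL Op ar) n → Vec (FormL Op ar) n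
    substVec σ []       = []
    substVec σ (x ∷ xs) = substL σ x ∷ substVec σ xs

  emb4 : Fm4 → FormL Op ar
  emb4 (v4 n)     = vL n
  emb4 (and4 φ ψ) = andL (emb4 φ) (emb4 ψ)
  emb4 (or4 φ ψ)  = orL (emb4 φ) (emb4 ψ)
  emb4 (imp4 φ ψ) = impL (emb4 φ) (emb4 ψ)
  emb4 (neg4 φ)   = negL (emb4 φ)

record Logic (Op : Set) (ar : Op → ℕ) : Set₁ where
  field
    _⊢_        : (FormL Op ar → Set) → FormL Op ar → Set
    reflexive  : ∀ Γ φ → Γ φ → Γ ⊢ φ
    monotone   : ∀ Γ Δ φ → (∀ ψ → Γ ψ → Δ ψ) → Γ ⊢ φ → Δ ⊢ φ
    cut        : ∀ Γ Δ φ → (∀ ψ → Δ ψ → Γ ⊢ ψ) → Δ ⊢ φ → Γ ⊢ φ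
    structural : ∀ σ Γ φ → Γ ⊢ φ → image (substL σ) Γ ⊢ substL σ φ

ConservativeExpansionOfN4 : {Op : Set} {ar : Op → ℕ} → Logic Op ar → Set₁
ConservativeExpansionOfN4 L =
  ∀ (Γ : Fm4 → Set) (φ : Fm4) → (image emb4 Γ ⊢ emb4 φ) ⇔ (Γ ⊢N4 φ)
  where open Logic L

-- The common language ⟨∧,∨,⊸,¬⟩, where ⊸ is the implication being
-- identified with ⇒ of S.

data CF : Set where
  vC   : ℕ → CF
  andC : CF → CF → CF
  orC  : CF → CF → CF
  impC : CF → CF → CF
  negC : CF → CF

cfS : CF → FmS
cfS (vC n)     = vS n
cfS (andC φ ψ) = andS (cfS φ) (cfS ψ)
cfS (orC φ ψ)  = orS (cfS φ) (cfS ψ)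
cfS (impC φ ψ) = impS (cfS φ) (cfS ψ)
cfS (negC φ)   = negS (cfS φ)

module _ {Op : Set} {ar : Op → ℕ} where

  cfWeak : CF → FormL Op ar
  cfWeak (vC n)     = vL n
  cfWeak (andC φ ψ) = andL (cfWeak φ) (cfWeak ψ)
  cfWeak (orC φ ψ)  = orL (cfWeak φ) (cfWeak ψ)
  cfWeak (impC φ ψ) = impL (cfWeak φ) (cfWeak ψ)
  cfWeak (negC φ)   = negL (cfWeak φ)

  cfStrong : CF → FormL Op ar
  cfStrong (vC n)     = vL n
  cfStrong (andC φ ψ) = andL (cfStrong φ) (cfStrong ψ)
  cfStrong (orC φ ψ)  = orL (cfStrong φ) (cfStrong ψ)
  cfStrong (impC φ ψ) =
    andL (impL (cfStrong φ) (cfStrong ψ)) (impL (negL (cfStrong ψ)) (negL (cfStrong φ)))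
  cfStrong (negC φ)   = negL (cfStrong φ)

Contained : {A B : Set} → ((A → Set) → A → Set) → (CF → A)
          → ((B → Set) → B → Set) → (CF → B) → Set₁
Contained ⊢A tA ⊢B tB =
  ∀ (Γ : CF → Set) (φ : CF) → ⊢A (image tA Γ) (tA φ) → ⊢B (image tB Γ) (tB φ)

Incomparable : {A B : Set} → ((A → Set) → A → Set) → (CF → A)
             → ((B → Set) → B → Set) → (CF → B) → Set₁
Incomparable ⊢A tA ⊢B tB =
  ¬ Contained ⊢A tA ⊢B tB × ¬ Contained ⊢B tB ⊢A tA

module Submission where

-- Two inferences separate the logics, each written in the common language
-- with ⊸ standing for the identified implication:
--   * contraction  Γ₀ = {p ⊸ (p ⊸ q), ¬q ⊸ (¬q ⊸ ¬p)} ⊢ p ⊸ q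
--     holds in N4 for both readings of ⊸ but fails in S, which has no
--     contraction rule: a six-element chain validating S refutes it;
--   * explosion  Γ₁ = {p, ¬p} ⊢ q  holds in S (axioms A2, A3) but fails in
--     the paraconsistent N4, refuted by the four-valued Belnap–Dunn matrix.  Finally,
-- a conservative expansion L agrees with N4 on every set of formulas coming
-- from the common language, and incomparability transfers from N4 to L.

open import Defs
open import Data.Nat using (ℕ; zero; suc; _≤ᵇ_; _≡ᵇ_)
open import Data.Fin using (Fin; toℕ; opposite)
open import Data.Vec using (Vec; []; _∷_; lookup)
open import Data.Bool using (Bool; true; false; T; not; _∧_; _∨_; if_then_else_)
open import Data.Unit using (tt)
open import Data.Product using (_×_; _,_; proj₁; proj₂)
open import Data.Sum using (_⊎_; inj₁; inj₂)
open import Data.List using (List; []; _∷_; allFin)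
open import Data.Bool.ListAction using (all)
open import Data.List.Membership.Propositional using (_∈_)
open import Data.List.Membership.Propositional.Properties using (∈-allFin)
open import Data.List.Relation.Unary.Any using (here; there)
open import Data.List.Relation.Unary.All.Properties using (all⁺)
import Data.List.Relation.Unary.All as All
open import Relation.Nullary using (¬_)
open import Relation.Binary.PropositionalEquality
  using (_≡_; refl; sym; trans; cong; cong₂; subst)

record Finite (A : Set) : Set where
  field
    elements : List A
    complete : ∀ x → x ∈ elements

_⟹_ : Bool → Bool → Bool
a ⟹ b = not a ∨ b

infixr 2 _⟹_

T-⟹ : ∀ {a b} → T (a ⟹ b) → T a → T b
T-⟹ {true} ab _ = ab

module Exhaustive {A : Set} (fin : Finite A) where
  open Finite fin

  every : (A → Bool) → Bool
  every f = all f elements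

  check₁ : ∀ (f : A → Bool) → T (every f) → ∀ x → T (f x)
  check₁ f ok x = All.lookup (all⁺ f elements ok) (complete x)

  check₂ : ∀ (f : A → A → Bool) → T (every λ x → every (f x)) → ∀ x y → T (f x y)
  check₂ f ok x = check₁ (f x) (check₁ _ ok x)

  check₃ : ∀ (f : A → A → A → Bool) →
           T (every λ x → every λ y → every (f x y)) → ∀ x y z → T (f x y z)
  check₃ f ok x = check₂ (f x) (check₁ _ ok x)

  check₄ : ∀ (f : A → A → A → A → Bool) →
           T (every λ x → every λ y → every λ z → every (f x y z)) →
           ∀ x y z u → T (f x y z u)
  check₄ f ok x = check₃ (f x) (check₁ _ ok x)

-- An algebra for the language of S with a set of designated values, subject
-- to exactly the conditions under which every axiom of S is designated and
-- every rule of S preserves designation.  Rules acting inside a context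
-- Γ ⇒ _ (resp. Γ ⇒² _) are justified by an entailment (resp. a doubled
-- entailment) between their premiss and conclusion which survives prefixing.
record SMatrix : Set₁ where
  infixr 5 _⇛_
  infixr 6 _⊔_
  infixr 7 _⊓_
  infix 8 ∼_
  infix 4 _≼_ _≼²_
  field
    Carrier        : Set
    _⊓_ _⊔_ _⇛_    : Carrier → Carrier → Carrier
    ∼_             : Carrier → Carrier
    bottom         : Carrier
    Designated     : Carrier → Set

  _≼_ : Carrier → Carrier → Set
  x ≼ y = Designated (x ⇛ y)

  _≼²_ : Carrier → Carrier → Set
  x ≼² y = Designated (x ⇛ (x ⇛ y))

  field
    detach   : ∀ x y → x ≼ y → Designated x → Designated y
    detach²  : ∀ x y → x ≼² y → Designated x → Designated y
    detach⊓  : ∀ x y z → x ⊓ y ≼ z → Designated x → Designated y → Designated z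
    prefix   : ∀ h x y → x ≼ y → h ⇛ x ≼ h ⇛ y
    prefix²  : ∀ h x y → x ≼² y → h ⇛ (h ⇛ x) ≼² h ⇛ (h ⇛ y)
    prefix⊓  : ∀ h x y z → x ⊓ y ≼ z → (h ⇛ x) ⊓ (h ⇛ y) ≼ h ⇛ z
    valid-A1 : ∀ x → x ≼ x
    valid-A2 : ∀ x → bottom ≼ x
    valid-A3 : ∀ x → ∼ x ≼ x ⇛ bottom
    valid-A4 : Designated (∼ bottom)
    valid-A5 : ∀ x y → Designated (((x ⇛ y) ⇛ ∼ y ⇛ ∼ x) ⊓ ((∼ y ⇛ ∼ x) ⇛ x ⇛ y))
    -- the remaining rules (rule E needs no condition of its own)
    rule-P   : ∀ x y g → x ⇛ y ⇛ g ≼ y ⇛ x ⇛ g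
    rule-C   : ∀ x g → x ≼² x ⇛ g → x ≼² g
    rule-⇒l  : ∀ x y g → y ≼ g → x ≼ (x ⇛ y) ⇛ g
    rule-⇒r  : ∀ x g → Designated g → Designated (x ⇛ g)
    rule-∧l1 : ∀ x y g → x ≼ g → x ⊓ y ≼ g
    rule-∧l2 : ∀ x y g → y ≼ g → x ⊓ y ≼ g
    rule-∨l1 : ∀ x y g → x ≼ g → y ≼ g → x ⊔ y ≼ g
    rule-∨l2 : ∀ x y g → x ≼² g → y ≼² g → x ⊔ y ≼² g
    rule-∨r1 : ∀ x y → x ≼ x ⊔ y
    rule-∨r2 : ∀ x y → y ≼ x ⊔ y
    rule-¬⇒l : ∀ x y g → x ⊓ ∼ y ≼ g → ∼ (x ⇛ y) ≼ g
    rule-¬⇒r : ∀ x y → x ⊓ ∼ y ≼² ∼ (x ⇛ y)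
    rule-¬∧l : ∀ x y g → ∼ x ⊔ ∼ y ≼ g → ∼ (x ⊓ y) ≼ g
    rule-¬∧r : ∀ x y → ∼ x ⊔ ∼ y ≼ ∼ (x ⊓ y)
    rule-¬∨l : ∀ x y g → ∼ x ⊓ ∼ y ≼ g → ∼ (x ⊔ y) ≼ g
    rule-¬∨r : ∀ x y → ∼ x ⊓ ∼ y ≼ ∼ (x ⊔ y)
    rule-¬¬l : ∀ x g → x ≼ g → ∼ ∼ x ≼ g
    rule-¬¬r : ∀ x → x ≼ ∼ ∼ x

module SSoundness (M : SMatrix) (e : ℕ → SMatrix.Carrier M) where
  open SMatrix M

  ⟦_⟧ : FmS → Carrier
  ⟦ vS n ⟧     = e n
  ⟦ andS φ ψ ⟧ = ⟦ φ ⟧ ⊓ ⟦ ψ ⟧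
  ⟦ orS φ ψ ⟧  = ⟦ φ ⟧ ⊔ ⟦ ψ ⟧
  ⟦ impS φ ψ ⟧ = ⟦ φ ⟧ ⇛ ⟦ ψ ⟧
  ⟦ negS φ ⟧   = ∼ ⟦ φ ⟧
  ⟦ zeroS ⟧    = bottom

  along : ∀ Γ φ ψ → ⟦ φ ⟧ ≼ ⟦ ψ ⟧ → Designated ⟦ chain Γ φ ⟧ → Designated ⟦ chain Γ ψ ⟧
  along Γ φ ψ r = detach _ _ (prefixes Γ r)
    where
    prefixes : ∀ Γ → ⟦ φ ⟧ ≼ ⟦ ψ ⟧ → ⟦ chain Γ φ ⟧ ≼ ⟦ chain Γ ψ ⟧
    prefixes []      r = r
    prefixes (h ∷ Γ) r = prefix ⟦ h ⟧ _ _ (prefixes Γ r)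

  along² : ∀ Γ φ ψ → ⟦ φ ⟧ ≼² ⟦ ψ ⟧ → Designated ⟦ chain2 Γ φ ⟧ → Designated ⟦ chain2 Γ ψ ⟧
  along² Γ φ ψ r = detach² _ _ (prefixes Γ r)
    where
    prefixes : ∀ Γ → ⟦ φ ⟧ ≼² ⟦ ψ ⟧ → ⟦ chain2 Γ φ ⟧ ≼² ⟦ chain2 Γ ψ ⟧
    prefixes []      r = r
    prefixes (h ∷ Γ) r = prefix² ⟦ h ⟧ _ _ (prefixes Γ r)

  along∧ : ∀ Γ φ ψ → Designated ⟦ chain Γ φ ⟧ → Designated ⟦ chain Γ ψ ⟧ →
           Designated ⟦ chain Γ (andS φ ψ) ⟧
  along∧ Γ φ ψ = detach⊓ _ _ _ (prefixes Γ)
    where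
    prefixes : ∀ Γ → ⟦ chain Γ φ ⟧ ⊓ ⟦ chain Γ ψ ⟧ ≼ ⟦ chain Γ (andS φ ψ) ⟧
    prefixes []      = valid-A1 _
    prefixes (h ∷ Γ) = prefix⊓ ⟦ h ⟧ _ _ _ (prefixes Γ)

  soundS : ∀ {Δ} → (∀ ψ → Δ ψ → Designated ⟦ ψ ⟧) → ∀ {φ} → Δ ⊢S φ → Designated ⟦ φ ⟧
  soundS H (hyp {φ} x)            = H φ x
  soundS H (a1 φ)                 = valid-A1 ⟦ φ ⟧
  soundS H (a2 ψ)                 = valid-A2 ⟦ ψ ⟧
  soundS H (a3 φ)                 = valid-A3 ⟦ φ ⟧
  soundS H a4                     = valid-A4
  soundS H (a5 φ ψ)               = valid-A5 ⟦ φ ⟧ ⟦ ψ ⟧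
  soundS H (rP Γ φ ψ γ D)         =
    along Γ _ _ (rule-P ⟦ φ ⟧ ⟦ ψ ⟧ ⟦ γ ⟧) (soundS H D)
  soundS H (rC φ γ D)             = rule-C ⟦ φ ⟧ ⟦ γ ⟧ (soundS H D)
  soundS H (rE Γ φ γ D₁ D₂)       = along Γ φ γ (soundS H D₂) (soundS H D₁)
  soundS H (r⇒l Γ φ ψ γ D₁ D₂)    =
    along Γ φ _ (rule-⇒l ⟦ φ ⟧ ⟦ ψ ⟧ ⟦ γ ⟧ (soundS H D₂)) (soundS H D₁)
  soundS H (r⇒r φ γ D)            = rule-⇒r ⟦ φ ⟧ ⟦ γ ⟧ (soundS H D)
  soundS H (r∧l1 φ ψ γ D)         = rule-∧l1 ⟦ φ ⟧ ⟦ ψ ⟧ ⟦ γ ⟧ (soundS H D)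
  soundS H (r∧l2 φ ψ γ D)         = rule-∧l2 ⟦ φ ⟧ ⟦ ψ ⟧ ⟦ γ ⟧ (soundS H D)
  soundS H (r∧r Γ φ ψ D₁ D₂)      = along∧ Γ φ ψ (soundS H D₁) (soundS H D₂)
  soundS H (r∨l1 φ ψ γ D₁ D₂)     =
    rule-∨l1 ⟦ φ ⟧ ⟦ ψ ⟧ ⟦ γ ⟧ (soundS H D₁) (soundS H D₂)
  soundS H (r∨l2 φ ψ γ D₁ D₂)     =
    rule-∨l2 ⟦ φ ⟧ ⟦ ψ ⟧ ⟦ γ ⟧ (soundS H D₁) (soundS H D₂)
  soundS H (r∨r1 Γ φ ψ D)         = along Γ φ _ (rule-∨r1 ⟦ φ ⟧ ⟦ ψ ⟧) (soundS H D)
  soundS H (r∨r2 Γ φ ψ D)         = along Γ ψ _ (rule-∨r2 ⟦ φ ⟧ ⟦ ψ ⟧) (soundS H D)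
  soundS H (r¬⇒l φ ψ γ D)         = rule-¬⇒l ⟦ φ ⟧ ⟦ ψ ⟧ ⟦ γ ⟧ (soundS H D)
  soundS H (r¬⇒r Γ φ ψ D)         = along² Γ _ _ (rule-¬⇒r ⟦ φ ⟧ ⟦ ψ ⟧) (soundS H D)
  soundS H (r¬∧l φ ψ γ D)         = rule-¬∧l ⟦ φ ⟧ ⟦ ψ ⟧ ⟦ γ ⟧ (soundS H D)
  soundS H (r¬∧r Γ φ ψ D)         = along Γ _ _ (rule-¬∧r ⟦ φ ⟧ ⟦ ψ ⟧) (soundS H D)
  soundS H (r¬∨l φ ψ γ D)         = rule-¬∨l ⟦ φ ⟧ ⟦ ψ ⟧ ⟦ γ ⟧ (soundS H D)
  soundS H (r¬∨r Γ φ ψ D)         = along Γ _ _ (rule-¬∨r ⟦ φ ⟧ ⟦ ψ ⟧) (soundS H D)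
  soundS H (r¬¬l φ γ D)           = rule-¬¬l ⟦ φ ⟧ ⟦ γ ⟧ (soundS H D)
  soundS H (r¬¬r Γ φ D)           = along Γ φ _ (rule-¬¬r ⟦ φ ⟧) (soundS H D)

record N4Matrix : Set₁ where
  infixr 5 _↦_
  infixr 6 _⊔_
  infixr 7 _⊓_
  infix 8 ∼_
  infix 4 _⇔ₘ_
  field
    Carrier     : Set
    _⊓_ _⊔_ _↦_ : Carrier → Carrier → Carrier
    ∼_          : Carrier → Carrier
    Designated  : Carrier → Set

  _⇔ₘ_ : Carrier → Carrier → Carrier
  x ⇔ₘ y = (x ↦ y) ⊓ (y ↦ x)

  field
    valid-N1  : ∀ x y → Designated (x ↦ y ↦ x)
    valid-N2  : ∀ x y z → Designated ((x ↦ y ↦ z) ↦ (x ↦ y) ↦ x ↦ z)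
    valid-N3  : ∀ x y → Designated (x ⊓ y ↦ x)
    valid-N4  : ∀ x y → Designated (x ⊓ y ↦ y)
    valid-N5  : ∀ x y z → Designated ((x ↦ y) ↦ (x ↦ z) ↦ x ↦ y ⊓ z)
    valid-N6  : ∀ x y → Designated (x ↦ x ⊔ y)
    valid-N7  : ∀ x y → Designated (y ↦ x ⊔ y)
    valid-N8  : ∀ x y z → Designated ((x ↦ z) ↦ (y ↦ z) ↦ x ⊔ y ↦ z)
    valid-N9  : ∀ x → Designated (∼ ∼ x ⇔ₘ x)
    valid-N10 : ∀ x y → Designated (∼ (x ⊔ y) ⇔ₘ ∼ x ⊓ ∼ y)
    valid-N11 : ∀ x y → Designated (∼ (x ⊓ y) ⇔ₘ ∼ x ⊔ ∼ y)
    valid-N12 : ∀ x y → Designated (∼ (x ↦ y) ⇔ₘ x ⊓ ∼ y)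
    valid-MP  : ∀ x y → Designated (x ↦ y) → Designated x → Designated y

module N4Soundness (M : N4Matrix) (e : ℕ → N4Matrix.Carrier M) where
  open N4Matrix M

  ⟦_⟧ : Fm4 → Carrier
  ⟦ v4 n ⟧     = e n
  ⟦ and4 φ ψ ⟧ = ⟦ φ ⟧ ⊓ ⟦ ψ ⟧
  ⟦ or4 φ ψ ⟧  = ⟦ φ ⟧ ⊔ ⟦ ψ ⟧
  ⟦ imp4 φ ψ ⟧ = ⟦ φ ⟧ ↦ ⟦ ψ ⟧
  ⟦ neg4 φ ⟧   = ∼ ⟦ φ ⟧

  soundN4 : ∀ {Γ} → (∀ ψ → Γ ψ → Designated ⟦ ψ ⟧) → ∀ {φ} → Γ ⊢N4 φ → Designated ⟦ φ ⟧
  soundN4 H (hyp {φ} x)        = H φ x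
  soundN4 H (n1 φ ψ)           = valid-N1 ⟦ φ ⟧ ⟦ ψ ⟧
  soundN4 H (n2 φ ψ γ)         = valid-N2 ⟦ φ ⟧ ⟦ ψ ⟧ ⟦ γ ⟧
  soundN4 H (n3 φ ψ)           = valid-N3 ⟦ φ ⟧ ⟦ ψ ⟧
  soundN4 H (n4 φ ψ)           = valid-N4 ⟦ φ ⟧ ⟦ ψ ⟧
  soundN4 H (n5 φ ψ γ)         = valid-N5 ⟦ φ ⟧ ⟦ ψ ⟧ ⟦ γ ⟧
  soundN4 H (n6 φ ψ)           = valid-N6 ⟦ φ ⟧ ⟦ ψ ⟧
  soundN4 H (n7 φ ψ)           = valid-N7 ⟦ φ ⟧ ⟦ ψ ⟧
  soundN4 H (n8 φ ψ γ)         = valid-N8 ⟦ φ ⟧ ⟦ ψ ⟧ ⟦ γ ⟧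
  soundN4 H (n9 φ)             = valid-N9 ⟦ φ ⟧
  soundN4 H (n10 φ ψ)          = valid-N10 ⟦ φ ⟧ ⟦ ψ ⟧
  soundN4 H (n11 φ ψ)          = valid-N11 ⟦ φ ⟧ ⟦ ψ ⟧
  soundN4 H (n12 φ ψ)          = valid-N12 ⟦ φ ⟧ ⟦ ψ ⟧
  soundN4 H (mp {φ} {ψ} D₁ D₂) = valid-MP ⟦ φ ⟧ ⟦ ψ ⟧ (soundN4 H D₁) (soundN4 H D₂)

-- Values are pairs (told true, told false); the connectives are the twist
-- operations over the two-element Boolean algebra, and a value is
-- designated when it is at least told true.  It validates N4 while the
-- value (true, true) makes both p and ¬p designated.
module BelnapDunn where
  Four : Set
  Four = Bool × Bool

  finite : Finite Four
  finite = record
    { elements = (false , false) ∷ (false , true) ∷ (true , false) ∷ (true , true) ∷ []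
    ; complete = λ
      { (false , false) → here refl
      ; (false , true)  → there (here refl)
      ; (true , false)  → there (there (here refl))
      ; (true , true)   → there (there (there (here refl)))
      }
    }

  open Exhaustive finite

  infixr 5 _↦_
  infixr 6 _⊔_
  infixr 7 _⊓_
  infix 8 ∼_
  infix 4 _⇔ᵇ_

  _⊓_ _⊔_ _↦_ : Four → Four → Four
  (a , b) ⊓ (c , d) = a ∧ c , b ∨ d
  (a , b) ⊔ (c , d) = a ∨ c , b ∧ d
  (a , b) ↦ (c , d) = not a ∨ c , a ∧ d

  ∼_ : Four → Four
  ∼ (a , b) = b , a

  isTrue : Four → Bool
  isTrue = proj₁

  _⇔ᵇ_ : Four → Four → Four
  x ⇔ᵇ y = (x ↦ y) ⊓ (y ↦ x)

  matrix : N4Matrix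
  matrix = record
    { Carrier    = Four
    ; _⊓_        = _⊓_
    ; _⊔_        = _⊔_
    ; _↦_        = _↦_
    ; ∼_         = ∼_
    ; Designated = λ x → T (isTrue x)
    ; valid-N1   = check₂ _ tt
    ; valid-N2   = check₃ _ tt
    ; valid-N3   = check₂ _ tt
    ; valid-N4   = check₂ _ tt
    ; valid-N5   = check₃ _ tt
    ; valid-N6   = check₂ _ tt
    ; valid-N7   = check₂ _ tt
    ; valid-N8   = check₃ _ tt
    ; valid-N9   = check₁ (λ x → isTrue (∼ ∼ x ⇔ᵇ x)) tt
    ; valid-N10  = check₂ (λ x y → isTrue (∼ (x ⊔ y) ⇔ᵇ ∼ x ⊓ ∼ y)) tt
    ; valid-N11  = check₂ (λ x y → isTrue (∼ (x ⊓ y) ⇔ᵇ ∼ x ⊔ ∼ y)) tt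
    ; valid-N12  = check₂ (λ x y → isTrue (∼ (x ↦ y) ⇔ᵇ x ⊓ ∼ y)) tt
    ; valid-MP   = λ x y r → T-⟹ (T-⟹
        (check₂ (λ x y → isTrue (x ↦ y) ⟹ isTrue x ⟹ isTrue y) tt x y) r)
    }

-- Under
-- p = 2, q = 1 both p ⇛ (p ⇛ q) and ¬q ⇛ (¬q ⇛ ¬p) are 5 while p ⇛ q = 4.
module SixChain where
  open import Agda.Builtin.FromNat using (Number; fromNat)
  import Data.Nat.Literals as ℕLit
  import Data.Fin.Literals as FinLit

  instance
    ℕ-literals : Number ℕ
    ℕ-literals = ℕLit.number

    six-literals : Number (Fin 6)
    six-literals = FinLit.number 6

  Six : Set
  Six = Fin 6

  finite : Finite Six
  finite = record { elements = allFin 6 ; complete = ∈-allFin }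

  open Exhaustive finite

  infixr 5 _⇛_
  infixr 6 _⊔_
  infixr 7 _⊓_
  infix 8 ∼_
  infix 4 _≤?_ _≤²?_

  _⊓_ _⊔_ : Six → Six → Six
  x ⊓ y = if toℕ x ≤ᵇ toℕ y then x else y
  x ⊔ y = if toℕ x ≤ᵇ toℕ y then y else x

  ∼_ : Six → Six
  ∼_ = opposite

  -- row x lists x ⇛ y for y = 0, …, 5
  implication : Vec (Vec Six 6) 6
  implication = (5 ∷ 5 ∷ 5 ∷ 5 ∷ 5 ∷ 5 ∷ [])
              ∷ (4 ∷ 5 ∷ 5 ∷ 5 ∷ 5 ∷ 5 ∷ [])
              ∷ (3 ∷ 4 ∷ 5 ∷ 5 ∷ 5 ∷ 5 ∷ [])
              ∷ (2 ∷ 2 ∷ 2 ∷ 5 ∷ 5 ∷ 5 ∷ [])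
              ∷ (1 ∷ 2 ∷ 2 ∷ 4 ∷ 5 ∷ 5 ∷ [])
              ∷ (0 ∷ 1 ∷ 2 ∷ 3 ∷ 4 ∷ 5 ∷ [])
              ∷ []

  _⇛_ : Six → Six → Six
  x ⇛ y = lookup (lookup implication x) y

  isTop : Six → Bool
  isTop x = toℕ x ≡ᵇ 5

  _≤?_ _≤²?_ : Six → Six → Bool
  x ≤? y  = isTop (x ⇛ y)
  x ≤²? y = isTop (x ⇛ x ⇛ y)

  matrix : SMatrix
  matrix = record
    { Carrier    = Six
    ; _⊓_        = _⊓_
    ; _⊔_        = _⊔_
    ; _⇛_        = _⇛_
    ; ∼_         = ∼_
    ; bottom     = 0
    ; Designated = λ x → T (isTop x)
    ; detach     = λ x y r → T-⟹ (T-⟹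
        (check₂ (λ x y → x ≤? y ⟹ isTop x ⟹ isTop y) tt x y) r)
    ; detach²    = λ x y r → T-⟹ (T-⟹
        (check₂ (λ x y → x ≤²? y ⟹ isTop x ⟹ isTop y) tt x y) r)
    ; detach⊓    = λ x y z r dx → T-⟹ (T-⟹ (T-⟹
        (check₃ (λ x y z → x ⊓ y ≤? z ⟹ isTop x ⟹ isTop y ⟹ isTop z) tt x y z) r) dx)
    ; prefix     = λ h x y →
        T-⟹ (check₃ (λ h x y → x ≤? y ⟹ (h ⇛ x) ≤? (h ⇛ y)) tt h x y)
    ; prefix²    = λ h x y →
        T-⟹ (check₃ (λ h x y → x ≤²? y ⟹ (h ⇛ h ⇛ x) ≤²? (h ⇛ h ⇛ y)) tt h x y)
    ; prefix⊓    = λ h x y z →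
        T-⟹ (check₄ (λ h x y z → x ⊓ y ≤? z ⟹ (h ⇛ x) ⊓ (h ⇛ y) ≤? h ⇛ z) tt h x y z)
    ; valid-A1   = check₁ (λ x → x ≤? x) tt
    ; valid-A2   = check₁ (λ x → 0 ≤? x) tt
    ; valid-A3   = check₁ (λ x → ∼ x ≤? x ⇛ 0) tt
    ; valid-A4   = tt
    ; valid-A5   = check₂ (λ x y → isTop (((x ⇛ y) ⇛ ∼ y ⇛ ∼ x) ⊓ ((∼ y ⇛ ∼ x) ⇛ x ⇛ y))) tt
    ; rule-P     = check₃ (λ x y g → (x ⇛ y ⇛ g) ≤? (y ⇛ x ⇛ g)) tt
    ; rule-C     = λ x g → T-⟹ (check₂ (λ x g → x ≤²? x ⇛ g ⟹ x ≤²? g) tt x g)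
    ; rule-⇒l    = λ x y g → T-⟹ (check₃ (λ x y g → y ≤? g ⟹ x ≤? (x ⇛ y) ⇛ g) tt x y g)
    ; rule-⇒r    = λ x g → T-⟹ (check₂ (λ x g → isTop g ⟹ isTop (x ⇛ g)) tt x g)
    ; rule-∧l1   = λ x y g → T-⟹ (check₃ (λ x y g → x ≤? g ⟹ x ⊓ y ≤? g) tt x y g)
    ; rule-∧l2   = λ x y g → T-⟹ (check₃ (λ x y g → y ≤? g ⟹ x ⊓ y ≤? g) tt x y g)
    ; rule-∨l1   = λ x y g r → T-⟹ (T-⟹
        (check₃ (λ x y g → x ≤? g ⟹ y ≤? g ⟹ x ⊔ y ≤? g) tt x y g) r)
    ; rule-∨l2   = λ x y g r → T-⟹ (T-⟹
        (check₃ (λ x y g → x ≤²? g ⟹ y ≤²? g ⟹ x ⊔ y ≤²? g) tt x y g) r)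
    ; rule-∨r1   = check₂ (λ x y → x ≤? x ⊔ y) tt
    ; rule-∨r2   = check₂ (λ x y → y ≤? x ⊔ y) tt
    ; rule-¬⇒l   = λ x y g →
        T-⟹ (check₃ (λ x y g → x ⊓ ∼ y ≤? g ⟹ ∼ (x ⇛ y) ≤? g) tt x y g)
    ; rule-¬⇒r   = check₂ (λ x y → x ⊓ ∼ y ≤²? ∼ (x ⇛ y)) tt
    ; rule-¬∧l   = λ x y g →
        T-⟹ (check₃ (λ x y g → ∼ x ⊔ ∼ y ≤? g ⟹ ∼ (x ⊓ y) ≤? g) tt x y g)
    ; rule-¬∧r   = check₂ (λ x y → ∼ x ⊔ ∼ y ≤? ∼ (x ⊓ y)) tt
    ; rule-¬∨l   = λ x y g →
        T-⟹ (check₃ (λ x y g → ∼ x ⊓ ∼ y ≤? g ⟹ ∼ (x ⊔ y) ≤? g) tt x y g)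
    ; rule-¬∨r   = check₂ (λ x y → ∼ x ⊓ ∼ y ≤? ∼ (x ⊔ y)) tt
    ; rule-¬¬l   = λ x g → T-⟹ (check₂ (λ x g → x ≤? g ⟹ ∼ ∼ x ≤? g) tt x g)
    ; rule-¬¬r   = check₁ (λ x → x ≤? ∼ ∼ x) tt
    }

  counterexample : ℕ → Six
  counterexample zero    = 2
  counterexample (suc _) = 1

module _ {Γ : Fm4 → Set} where
  identityN4 : ∀ a → Γ ⊢N4 imp4 a a
  identityN4 a = mp (mp (n2 a (imp4 a a) a) (n1 a (imp4 a a))) (n1 a a)

  composeN4 : ∀ {a b c} → Γ ⊢N4 imp4 a b → Γ ⊢N4 imp4 b c → Γ ⊢N4 imp4 a c
  composeN4 {a} {b} {c} ab bc = mp (mp (n2 a b c) (mp (n1 (imp4 b c) a) bc)) ab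

  contractN4 : ∀ {a b} → Γ ⊢N4 imp4 a (imp4 a b) → Γ ⊢N4 imp4 a b
  contractN4 {a} {b} aab = mp (mp (n2 a a b) aab) (identityN4 a)

  conjoinN4 : ∀ {a b} → Γ ⊢N4 a → Γ ⊢N4 b → Γ ⊢N4 and4 a b
  conjoinN4 {a} {b} da db = mp (mp (mp (n5 a a b) (identityN4 a)) (mp (n1 b a) db)) da

  firstN4 : ∀ {a b} → Γ ⊢N4 and4 a b → Γ ⊢N4 a
  firstN4 {a} {b} = mp (n3 a b)

strongImp4 : Fm4 → Fm4 → Fm4
strongImp4 a b = and4 (imp4 a b) (imp4 (neg4 b) (neg4 a))

weak4 : CF → Fm4
weak4 (vC n)     = v4 n
weak4 (andC φ ψ) = and4 (weak4 φ) (weak4 ψ)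
weak4 (orC φ ψ)  = or4 (weak4 φ) (weak4 ψ)
weak4 (impC φ ψ) = imp4 (weak4 φ) (weak4 ψ)
weak4 (negC φ)   = neg4 (weak4 φ)

strong4 : CF → Fm4
strong4 (vC n)     = v4 n
strong4 (andC φ ψ) = and4 (strong4 φ) (strong4 ψ)
strong4 (orC φ ψ)  = or4 (strong4 φ) (strong4 ψ)
strong4 (impC φ ψ) = strongImp4 (strong4 φ) (strong4 ψ)
strong4 (negC φ)   = neg4 (strong4 φ)

module _ {Op : Set} {ar : Op → ℕ} where
  emb4-weak4 : ∀ φ → emb4 {Op} {ar} (weak4 φ) ≡ cfWeak φ
  emb4-weak4 (vC n)     = refl
  emb4-weak4 (andC φ ψ) = cong₂ andL (emb4-weak4 φ) (emb4-weak4 ψ)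
  emb4-weak4 (orC φ ψ)  = cong₂ orL (emb4-weak4 φ) (emb4-weak4 ψ)
  emb4-weak4 (impC φ ψ) = cong₂ impL (emb4-weak4 φ) (emb4-weak4 ψ)
  emb4-weak4 (negC φ)   = cong negL (emb4-weak4 φ)

  emb4-strong4 : ∀ φ → emb4 {Op} {ar} (strong4 φ) ≡ cfStrong φ
  emb4-strong4 (vC n)     = refl
  emb4-strong4 (andC φ ψ) = cong₂ andL (emb4-strong4 φ) (emb4-strong4 ψ)
  emb4-strong4 (orC φ ψ)  = cong₂ orL (emb4-strong4 φ) (emb4-strong4 ψ)
  emb4-strong4 (impC φ ψ) = cong₂ (λ a b → andL (impL a b) (impL (negL b) (negL a)))
                                  (emb4-strong4 φ) (emb4-strong4 ψ)
  emb4-strong4 (negC φ)   = cong negL (emb4-strong4 φ)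

pair : {A : Set} → A → A → A → Set
pair a b x = x ≡ a ⊎ x ≡ b

p q : CF
p = vC 0
q = vC 1

contractionPremisses : CF → Set
contractionPremisses = pair (impC p (impC p q)) (impC (negC q) (impC (negC q) (negC p)))

contradictoryPremisses : CF → Set
contradictoryPremisses = pair p (negC p)

mpS : ∀ {Δ} φ γ → Δ ⊢S φ → Δ ⊢S impS φ γ → Δ ⊢S γ
mpS = rE []

explosionS : ∀ {Δ} φ ψ → Δ ⊢S φ → Δ ⊢S negS φ → Δ ⊢S ψ
explosionS φ ψ dφ d¬φ =
  mpS zeroS ψ (mpS φ zeroS dφ (mpS (negS φ) (impS φ zeroS) d¬φ (a3 φ))) (a2 ψ)

S-no-contraction : ¬ (image cfS contractionPremisses ⊢S cfS (impC p q))
S-no-contraction = soundS premisses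
  where
  open SSoundness SixChain.matrix SixChain.counterexample
  premisses : ∀ ψ → image cfS contractionPremisses ψ →
              SMatrix.Designated SixChain.matrix ⟦ ψ ⟧
  premisses _ (_ , inj₁ refl , refl) = tt
  premisses _ (_ , inj₂ refl , refl) = tt

-- N4 is paraconsistent: premisses among p, ¬p do not yield q, since the
-- Belnap–Dunn matrix designates p and ¬p when p is both true and false
N4-paraconsistent : ∀ {Γ} → (∀ χ → Γ χ → pair (v4 0) (neg4 (v4 0)) χ) → ¬ (Γ ⊢N4 v4 1)
N4-paraconsistent {Γ} only = soundN4 premisses
  where
  glut : ℕ → BelnapDunn.Four
  glut zero    = true , true
  glut (suc _) = false , false
  open N4Soundness BelnapDunn.matrix glut
  premisses : ∀ χ → Γ χ → N4Matrix.Designated BelnapDunn.matrix ⟦ χ ⟧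
  premisses χ χ∈Γ with only χ χ∈Γ
  ... | inj₁ refl = tt
  ... | inj₂ refl = tt

N4-incomparable-S : (t₄ : CF → Fm4) →
  (∀ n → t₄ (vC n) ≡ v4 n) → (∀ φ → t₄ (negC φ) ≡ neg4 (t₄ φ)) →
  image t₄ contractionPremisses ⊢N4 t₄ (impC p q) →
  Incomparable _⊢N4_ t₄ _⊢S_ cfS
N4-incomparable-S t₄ keepsVar keepsNeg contraction =
    (λ N4⊆S → S-no-contraction (N4⊆S contractionPremisses (impC p q) contraction))
  , (λ S⊆N4 → N4-paraconsistent literals
       (subst (image t₄ contradictoryPremisses ⊢N4_) (keepsVar 1)
              (S⊆N4 contradictoryPremisses q explosion)))
  where
  explosion : image cfS contradictoryPremisses ⊢S cfS q
  explosion = explosionS (vS 0) (vS 1) (hyp (p , inj₁ refl , refl))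
                                       (hyp (negC p , inj₂ refl , refl))
  literals : ∀ χ → image t₄ contradictoryPremisses χ → pair (v4 0) (neg4 (v4 0)) χ
  literals _ (_ , inj₁ refl , refl) = inj₁ (keepsVar 0)
  literals _ (_ , inj₂ refl , refl) = inj₂ (trans (keepsNeg p) (cong neg4 (keepsVar 0)))

weakContraction : image weak4 contractionPremisses ⊢N4 weak4 (impC p q)
weakContraction = contractN4 (hyp (_ , inj₁ refl , refl))

strongContraction : image strong4 contractionPremisses ⊢N4 strong4 (impC p q)
strongContraction = conjoinN4
  (contractN4 (composeN4 (firstN4 (hyp (_ , inj₁ refl , refl))) (n3 _ _)))
  (contractN4 (composeN4 (firstN4 (hyp (_ , inj₂ refl , refl))) (n3 _ _)))

transferIncomparable : {A A′ B : Set}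
  {⊢A : (A → Set) → A → Set} {⊢A′ : (A′ → Set) → A′ → Set} {⊢B : (B → Set) → B → Set}
  {tA : CF → A} {tA′ : CF → A′} {tB : CF → B} →
  (∀ Γ φ → ⊢A′ (image tA′ Γ) (tA′ φ) ⇔ ⊢A (image tA Γ) (tA φ)) →
  Incomparable ⊢A tA ⊢B tB → Incomparable ⊢A′ tA′ ⊢B tB
transferIncomparable same (A⊈B , B⊈A) =
    (λ A′⊆B → A⊈B (λ Γ φ D → A′⊆B Γ φ (proj₂ (same Γ φ) D)))
  , (λ B⊆A′ → B⊈A (λ Γ φ D → proj₁ (same Γ φ) (B⊆A′ Γ φ D)))

module Conservativity {Op : Set} {ar : Op → ℕ} (L : Logic Op ar)
                      (conservative : ConservativeExpansionOfN4 L) where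
  open Logic L

  agreesWithN4 : (t : CF → FormL Op ar) (t₄ : CF → Fm4) → (∀ φ → emb4 (t₄ φ) ≡ t φ) →
                 ∀ Γ φ → (image t Γ ⊢ t φ) ⇔ (image t₄ Γ ⊢N4 t₄ φ)
  agreesWithN4 t t₄ factors Γ φ = to , from
    where
    inN4 : (image emb4 (image t₄ Γ) ⊢ emb4 (t₄ φ)) ⇔ (image t₄ Γ ⊢N4 t₄ φ)
    inN4 = conservative (image t₄ Γ) (t₄ φ)

    throughN4 : ∀ ψ → image t Γ ψ → image emb4 (image t₄ Γ) ψ
    throughN4 _ (γ , γ∈Γ , refl) = t₄ γ , (γ , γ∈Γ , refl) , factors γ

    direct : ∀ ψ → image emb4 (image t₄ Γ) ψ → image t Γ ψ
    direct _ (_ , (γ , γ∈Γ , refl) , refl) = γ , γ∈Γ , sym (factors γ)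

    to : image t Γ ⊢ t φ → image t₄ Γ ⊢N4 t₄ φ
    to D = proj₁ inN4 (monotone _ _ _ throughN4 (subst (image t Γ ⊢_) (sym (factors φ)) D))

    from : image t₄ Γ ⊢N4 t₄ φ → image t Γ ⊢ t φ
    from D = subst (image t Γ ⊢_) (factors φ) (monotone _ _ _ direct (proj₂ inN4 D))

  inheritsIncomparability : (t : CF → FormL Op ar) (t₄ : CF → Fm4) →
    (∀ φ → emb4 (t₄ φ) ≡ t φ) →
    Incomparable _⊢N4_ t₄ _⊢S_ cfS → Incomparable _⊢_ t _⊢S_ cfS
  inheritsIncomparability t t₄ factors =
    transferIncomparable {⊢A = _⊢N4_} {⊢A′ = _⊢_} {⊢B = _⊢S_} {tA = t₄} {tA′ = t} {tB = cfS}
      (agreesWithN4 t t₄ factors)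

proposition6p3 : (Op : Set) (ar : Op → ℕ) (L : Logic Op ar)
    → ConservativeExpansionOfN4 L
    → Incomparable (Logic._⊢_ L) cfWeak _⊢S_ cfS
      × Incomparable (Logic._⊢_ L) cfStrong _⊢S_ cfS
proposition6p3 Op ar L conservative =
    inheritsIncomparability cfWeak weak4 emb4-weak4
      (N4-incomparable-S weak4 (λ _ → refl) (λ _ → refl) weakContraction)
  , inheritsIncomparability cfStrong strong4 emb4-strong4
      (N4-incomparable-S strong4 (λ _ → refl) (λ _ → refl) strongContraction)
  where
  open Conservativity L conservative
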